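{- Let $I=(G,s,t,\omega)$ be an instance of 2-SCSS-$(k,1)$ and let $I'$ be the associated token game described in the context. Then $\mathrm{OPT}(I)\ge \mathrm{OPT}(I')$, where $\mathrm{OPT}(I)$ is the optimum cost of the 2-SCSS-$(k,1)$ instance and $\mathrm{OPT}(I')$ is the minimum cost of a sequence of moves from the state $s^{k+1}$ to the state $t^{k+1}$.
   Context: 2-SCSS-$(k,1)$: given a directed graph $G=(V,E)$ with weights $\omega:E\to\mathbb{R}_{\geq0}$, vertices $s,t$ and integer $k\geq1$, find directed $s\to t$ paths $F_1,\dots,F_k$ and a directed $t\to s$ path $B$ minimizing $\sum_{e\in E}\omega(e)\max\{|\{i:e\in F_i\}|,\ [e\in B]\}$. Associated token game $I'$: tokens $\mathsf{b},\mathsf{f}_1,\dots,\mathsf{f}_k$; states are vectors $\bar v=(v_0,v_1,\dots,v_k)\in V^{k+1}$ ($v_0$ is the position of $\mathsf{b}$, $v_i$ of $\mathsf{f}_i$); for $v\in V$, $v^{k+1}$ is the state with all tokens at $v$. From each state $\bar v$ the allowed moves are: (1) Backward: for every edge $(w,v_0)\in E$, replace $v_0$ by $w$, cost $\omega(w,v_0)$; (2) Forward: for every $i\in[k]$ and edge $(v_i,x)\in E$, replace $v_i$ by $x$, cost $\omega(v_i,x)$; (3) Flip: for every $i\in[k]$, swap coordinates $0$ and $i$, cost equal to the weight of a shortest directed $v_i\to v_0$ path in $G$. The cost of a move sequence is the sum of costs of its moves.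
   Formalization: The edge weights take values in the nonnegative rationals instead of the nonnegative reals. -}

module Defs where

open import Data.Nat as ℕ using (ℕ; zero; suc)
open import Data.Fin using (Fin; zero; suc)
open import Data.Fin.Properties using () renaming (_≟_ to _≟ᶠ_)
open import Data.Bool using (Bool; true; false; _∧_; if_then_else_)
open import Data.List using (List; []; _∷_; allFin; map; filter; concatMap)
open import Data.Nat.ListAction using (sum)
open import Data.List.Relation.Unary.Unique.Propositional using (Unique)
open import Data.Vec using (Vec; _∷_; lookup; _[_]≔_; replicate)
open import Data.Rational using (ℚ; 0ℚ; _+_; _*_; _≤_; _/_)
open import Data.Integer using (+_)
open import Data.Product using (Σ; _×_; _,_; proj₁)
open import Relation.Nullary.Decidable using (⌊_⌋)
open import Relation.Binary.PropositionalEquality using (_≡_)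

Graph : ℕ → Set
Graph n = Fin n → Fin n → Bool

-- Edge weights (only their values on edges matter); nonnegativity is a
-- separate hypothesis.
Weight : ℕ → Set
Weight n = Fin n → Fin n → ℚ

NonNeg : ∀ {n} → Weight n → Set
NonNeg {n} ω = ∀ (u v : Fin n) → 0ℚ ≤ ω u v

module _ {n : ℕ} (E : Graph n) where

  data Walk : Fin n → Fin n → Set where
    []  : ∀ {u} → Walk u u
    _∷_ : ∀ {u w v} → E u w ≡ true → Walk w v → Walk u v

  vertices : ∀ {u v} → Walk u v → List (Fin n)
  vertices {u} []       = u ∷ []
  vertices {u} (_ ∷ W)  = u ∷ vertices W

  Path : Fin n → Fin n → Set
  Path u v = Σ (Walk u v) (λ W → Unique (vertices W))

  usesW : ∀ {u v} → Walk u v → Fin n → Fin n → Bool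
  usesW []                 a b = false
  usesW {u} (_∷_ {w = w} _ W) a b =
    if ⌊ u ≟ᶠ a ⌋ ∧ ⌊ w ≟ᶠ b ⌋ then true else usesW W a b

  uses : ∀ {u v} → Path u v → Fin n → Fin n → Bool
  uses P = usesW (proj₁ P)

  weightW : Weight n → ∀ {u v} → Walk u v → ℚ
  weightW ω []                    = 0ℚ
  weightW ω {u} (_∷_ {w = w} _ W) = ω u w + weightW ω W

  weight : Weight n → ∀ {u v} → Path u v → ℚ
  weight ω P = weightW ω (proj₁ P)

  Shortest : Weight n → ∀ {u v} → Path u v → Set
  Shortest ω {u} {v} P = ∀ (Q : Path u v) → weight ω P ≤ weight ω Q

  ℕtoℚ : ℕ → ℚ
  ℕtoℚ m = (+ m) / 1

  b2n : Bool → ℕ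
  b2n true  = 1
  b2n false = 0

  countUses : ∀ {k s t} → (Fin k → Path s t) → Fin n → Fin n → ℕ
  countUses {k} F a b = sum (map (λ i → b2n (uses (F i) a b)) (allFin k))

  edges : List (Fin n × Fin n)
  edges = concatMap (λ a → map (λ b → (a , b)) (filter (λ b → E a b ≟b true) (allFin n))) (allFin n)
    where
    open import Data.Bool.Properties using () renaming (_≟_ to _≟b_)

  scssCost : Weight n → ∀ {k s t} → (Fin k → Path s t) → Path t s → ℚ
  scssCost ω F B =
    sum′ (map (λ { (a , b) → ω a b * ℕtoℚ (countUses F a b ℕ.⊔ b2n (uses B a b)) }) edges)
    where
    sum′ : List ℚ → ℚ
    sum′ []       = 0ℚ
    sum′ (x ∷ xs) = x + sum′ xs

  -- State (v₀, v₁, …, v_k): index 0 is token b, index suc i is token f_{i+1}.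
  State : ℕ → Set
  State k = Vec (Fin n) (suc k)

  swap0 : ∀ {k} → State k → Fin k → State k
  swap0 σ i = (σ [ zero ]≔ lookup σ (suc i)) [ suc i ]≔ lookup σ zero

  data Move (ω : Weight n) {k : ℕ} : State k → ℚ → State k → Set where
    backward : ∀ σ w → E w (lookup σ zero) ≡ true →
               Move ω σ (ω w (lookup σ zero)) (σ [ zero ]≔ w)
    forward  : ∀ σ (i : Fin k) x → E (lookup σ (suc i)) x ≡ true →
               Move ω σ (ω (lookup σ (suc i)) x) (σ [ suc i ]≔ x)
    flip     : ∀ σ (i : Fin k) (P : Path (lookup σ (suc i)) (lookup σ zero)) →
               Shortest ω P →
               Move ω σ (weight ω P) (swap0 σ i)

  data Moves (ω : Weight n) {k : ℕ} : State k → ℚ → State k → Set where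
    done : ∀ {σ} → Moves ω σ 0ℚ σ
    step : ∀ {σ τ ρ c d} → Move ω σ c τ → Moves ω τ d ρ → Moves ω σ (c + d) ρ

  allAt : ∀ k → Fin n → State k
  allAt k v = replicate (suc k) v

module Submission where

-- Give every edge e a budget M(e), initially max {|{i : e ∈ Fᵢ}|, [e ∈ B]}, so that the cost
-- Σₑ ω(e) M(e) of the budget is the objective value of (F, B). During the game keep a simple walk
-- Pᵢ from each token fᵢ to t and a simple walk Q from t to the token b such that the Pᵢ use every
-- edge e at most M(e) times in total and every edge of Q has positive budget. Every move traverses
-- a simple walk with positive budget on all edges, costs at most its weight, and is paid for by
-- lowering those budgets by one:
--   * some fᵢ moves along the first edge of Pᵢ if its budget exceeds what Q still needs;
--   * otherwise b moves back along the last edge of Q if the Pᵢ leave it some budget;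
--   * otherwise that last edge lies on some Pⱼ, whose first edge lies on Q. Cut Pⱼ at b and Q at fⱼ.
--     If the part of Pⱼ up to b and the part of Q up to fⱼ share an edge, Q can be rerouted
--     through Pⱼ to avoid the first edge of Pⱼ, which fⱼ then takes; otherwise fⱼ and b flip along a
--     shortest path, paid for by the part of Pⱼ up to b.
-- The total budget decreases, so the game ends with all tokens at t, after paying at most the
-- cost of the initial budget.

open import Defs
open import Algebra.Bundles using (CommutativeMonoid)
open import Axiom.UniquenessOfIdentityProofs using (module Decidable⇒UIP)
open import Data.Bool using (T; T?; true; false; _∧_; _∨_)
import Data.Bool.Properties as Bool
open import Data.Empty using (⊥-elim)
open import Data.Fin using (Fin; zero; suc)
open import Data.Fin.Properties using (_≟_; any?; injective⇒≤)
import Data.Integer as ℤ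
import Data.Integer.Properties as ℤ
open import Data.List as List using (List; []; _∷_; map; allFin)
open import Data.List.Membership.Propositional using (_∈_; lose)
open import Data.List.Membership.Propositional.Properties
  using (∈-lookup; ∈-concatMap⁺; ∈-map⁺; ∈-allFin; ∈-upTo⁺; ∈-filter⁺)
open import Data.List.Relation.Unary.All as All using ([])
open import Data.List.Relation.Unary.All.Properties using (¬Any⇒All¬; All¬⇒¬Any)
open import Data.List.Relation.Unary.AllPairs using ([]; _∷_)
open import Data.List.Relation.Unary.Any using (here; there)
open import Data.List.Relation.Unary.Unique.Propositional using (Unique)
open import Data.Nat as ℕ using (ℕ; zero; suc; _≤_; _<_; _∸_; _⊔_; z≤n; s≤s)
open import Data.Nat.Induction using (<-wellFounded)
open import Data.Nat.ListAction using (sum)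
import Data.Nat.Properties as ℕ
open import Data.Product using (Σ; Σ-syntax; ∃-syntax; _×_; _,_; proj₁; proj₂)
open import Data.Rational as ℚ using (ℚ; 0ℚ; 1ℚ) renaming (_≤_ to _≤ℚ_)
import Data.Rational.Properties as ℚ
import Data.Rational.Unnormalised as ℚᵘ
import Data.Rational.Unnormalised.Properties as ℚᵘ
open import Data.Sum as Sum using (_⊎_; inj₁; inj₂; [_,_]′)
open import Data.Vec as Vec using (Vec; _∷_; lookup; _[_]≔_; replicate)
open import Data.Vec.Properties using (lookup∘update; lookup∘update′; lookup-replicate)
open import Function using (_∘_; id; Equivalence)
open import Induction.WellFounded using (Acc; acc)
open import Relation.Binary.Bundles using (DecTotalOrder)
open import Relation.Binary.PropositionalEquality
open import Relation.Nullary using (¬_; Dec; yes; no)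
open import Relation.Nullary.Decidable using (⌊_⌋; dec-yes-irr; _×-dec_)
open import Data.List.Extrema (DecTotalOrder.totalOrder ℚ.≤-decTotalOrder)
  using (argmin; f[argmin]≤f[xs]; f[argmin]≤f[⊤])

module _ {A : Set} where

  open import Data.Nat using (_+_)
  open import Algebra.Properties.CommutativeSemigroup ℕ.+-commutativeSemigroup using (xy∙z≈xz∙y)

  sum-map-mono : ∀ {f g : A → ℕ} → (∀ x → g x ≤ f x) → ∀ xs → sum (map g xs) ≤ sum (map f xs)
  sum-map-mono g≤f []       = z≤n
  sum-map-mono g≤f (x ∷ xs) = ℕ.+-mono-≤ (g≤f x) (sum-map-mono g≤f xs)

  sum-map-mono-+ : ∀ {f g : A → ℕ} {d y xs} → (∀ x → g x ≤ f x) → y ∈ xs → g y + d ≤ f y →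
                   sum (map g xs) + d ≤ sum (map f xs)
  sum-map-mono-+ {f} {g} {d} {y} {_ ∷ xs} g≤f (here refl) gy+d≤fy = begin
    g y + sum (map g xs) + d  ≡⟨ xy∙z≈xz∙y (g y) _ d ⟩
    g y + d + sum (map g xs)  ≤⟨ ℕ.+-mono-≤ gy+d≤fy (sum-map-mono g≤f xs) ⟩
    f y + sum (map f xs)      ∎
    where open ℕ.≤-Reasoning
  sum-map-mono-+ {f} {g} {d} {_} {x ∷ xs} g≤f (there y∈xs) gy+d≤fy = begin
    g x + sum (map g xs) + d    ≡⟨ ℕ.+-assoc (g x) _ d ⟩
    g x + (sum (map g xs) + d)  ≤⟨ ℕ.+-mono-≤ (g≤f x) (sum-map-mono-+ g≤f y∈xs gy+d≤fy) ⟩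
    f x + sum (map f xs)        ∎
    where open ℕ.≤-Reasoning

  ≤-sum-map : ∀ (f : A → ℕ) {y xs} → y ∈ xs → f y ≤ sum (map f xs)
  ≤-sum-map f {xs = x ∷ _}  (here refl)  = ℕ.m≤m+n (f x) _
  ≤-sum-map f {xs = x ∷ _}  (there y∈xs) = ℕ.m≤n⇒m≤o+n (f x) (≤-sum-map f y∈xs)

  sum-map-positive : ∀ {f : A → ℕ} xs → 0 < sum (map f xs) → ∃[ x ] 0 < f x
  sum-map-positive {f} (x ∷ xs) 0<sum with 0 ℕ.<? f x
  ... | yes 0<fx = x , 0<fx
  ... | no  0≮fx =
    sum-map-positive xs (subst (λ m → 0 < m + sum (map f xs)) (ℕ.n≤0⇒n≡0 (ℕ.≮⇒≥ 0≮fx)) 0<sum)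

module _ {n : ℕ} where

  unique⇒lookup-injective : ∀ {xs : List (Fin n)} → Unique xs →
                            ∀ {i j} → List.lookup xs i ≡ List.lookup xs j → i ≡ j
  unique⇒lookup-injective {_ ∷ _} (_  ∷ _) {zero}  {zero}  _  = refl
  unique⇒lookup-injective {_ ∷ _} (x∉ ∷ _) {zero}  {suc j} eq = ⊥-elim (All.lookup x∉ (∈-lookup j) eq)
  unique⇒lookup-injective {_ ∷ _} (x∉ ∷ _) {suc i} {zero}  eq = ⊥-elim (All.lookup x∉ (∈-lookup i) (sym eq))
  unique⇒lookup-injective {_ ∷ _} (_  ∷ u) {suc i} {suc j} eq = cong suc (unique⇒lookup-injective u eq)

  unique⇒length≤ : ∀ {xs : List (Fin n)} → Unique xs → List.length xs ≤ n
  unique⇒length≤ u = injective⇒≤ (unique⇒lookup-injective u)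

≡-replicate : ∀ {A : Set} {m} {x : A} (xs : Vec A m) → (∀ i → lookup xs i ≡ x) → xs ≡ replicate m x
≡-replicate Vec.[]   _     = refl
≡-replicate (_ ∷ xs) all≡x = cong₂ _∷_ (all≡x zero) (≡-replicate xs (all≡x ∘ suc))

q≥0⇒p≤q+p : ∀ {p q} → 0ℚ ≤ℚ q → p ≤ℚ q ℚ.+ p
q≥0⇒p≤q+p {p} {q} q≥0 = subst (_≤ℚ q ℚ.+ p) (ℚ.+-identityˡ p) (ℚ.+-monoˡ-≤ p q≥0)

list-induction : ∀ {a} {A : Set} {P : List A → Set a} →
                 P [] → (∀ x xs → P xs → P (x ∷ xs)) → ∀ xs → P xs
list-induction         p[] p∷ []       = p[]
list-induction {P = P} p[] p∷ (x ∷ xs) = p∷ x xs (list-induction {P = P} p[] p∷ xs)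

module Walks {n : ℕ} (E : Graph n) where

  open import Data.Nat using (_+_)
  open import Data.List.Membership.DecPropositional (_≟_ {n}) using (_∈?_)

  private variable
    u v w x y z a b : Fin n

  infixr 5 _++ʷ_
  _++ʷ_ : Walk E u z → Walk E z v → Walk E u v
  []      ++ʷ W₂ = W₂
  (e ∷ W₁) ++ʷ W₂ = e ∷ (W₁ ++ʷ W₂)

  Uses : Walk E u v → Fin n → Fin n → Set
  Uses W a b = T (usesW E W a b)

  infix 4 _⊆ᵉ_
  _⊆ᵉ_ : Walk E u v → Walk E x y → Set
  W ⊆ᵉ W′ = ∀ {a b} → Uses W a b → Uses W′ a b

  Simple : Walk E u v → Set
  Simple W = Unique (vertices E W)

  uses-++ : (W₁ : Walk E u z) (W₂ : Walk E z v) (a b : Fin n) →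
            usesW E (W₁ ++ʷ W₂) a b ≡ usesW E W₁ a b ∨ usesW E W₂ a b
  uses-++ []                      W₂ a b = refl
  uses-++ {u} (_∷_ {w = w} _ W₁) W₂ a b with ⌊ u ≟ a ⌋ ∧ ⌊ w ≟ b ⌋
  ... | true  = refl
  ... | false = uses-++ W₁ W₂ a b

  uses-++⁺ˡ : (W₁ : Walk E u z) (W₂ : Walk E z v) → Uses W₁ a b → Uses (W₁ ++ʷ W₂) a b
  uses-++⁺ˡ {a = a} {b} W₁ W₂ h =
    subst T (sym (uses-++ W₁ W₂ a b)) (Equivalence.from Bool.T-∨ (inj₁ h))

  uses-++⁺ʳ : (W₁ : Walk E u z) (W₂ : Walk E z v) → Uses W₂ a b → Uses (W₁ ++ʷ W₂) a b
  uses-++⁺ʳ {a = a} {b} W₁ W₂ h =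
    subst T (sym (uses-++ W₁ W₂ a b)) (Equivalence.from Bool.T-∨ (inj₂ h))

  uses-++⁻ : (W₁ : Walk E u z) (W₂ : Walk E z v) →
             Uses (W₁ ++ʷ W₂) a b → Uses W₁ a b ⊎ Uses W₂ a b
  uses-++⁻ {a = a} {b} W₁ W₂ h = Equivalence.to Bool.T-∨ (subst T (uses-++ W₁ W₂ a b) h)

  uses-edge⁺ : (e : E u w ≡ true) → Uses (e ∷ []) u w
  uses-edge⁺ {u} {w} e with u ≟ u | w ≟ w
  ... | yes _ | yes _  = _
  ... | no u≢u | _     = u≢u refl
  ... | yes _ | no w≢w = w≢w refl

  uses-edge⁻ : (e : E u w ≡ true) → Uses (e ∷ []) a b → u ≡ a × w ≡ b
  uses-edge⁻ {u} {w} {a} {b} e h with u ≟ a | w ≟ b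
  ... | yes u≡a | yes w≡b = u≡a , w≡b
  ... | yes _   | no _    = ⊥-elim h
  ... | no _    | _       = ⊥-elim h

  uses-∷⁻ : (e : E u w ≡ true) (W : Walk E w v) → Uses (e ∷ W) a b → (u ≡ a × w ≡ b) ⊎ Uses W a b
  uses-∷⁻ e W h = Sum.map₁ (uses-edge⁻ e) (uses-++⁻ (e ∷ []) W h)

  uses⇒edge : (W : Walk E u v) → Uses W a b → E a b ≡ true
  uses⇒edge (e ∷ W) h with uses-∷⁻ e W h
  ... | inj₁ (refl , refl) = e
  ... | inj₂ h′            = uses⇒edge W h′

  start∈ : (W : Walk E u v) → u ∈ vertices E W
  start∈ []      = here refl
  start∈ (_ ∷ _) = here refl

  end∈ : (W : Walk E u v) → v ∈ vertices E W
  end∈ []      = here refl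
  end∈ (_ ∷ W) = there (end∈ W)

  uses⇒source∈ : (W : Walk E u v) → Uses W a b → a ∈ vertices E W
  uses⇒source∈ (e ∷ W) h with uses-∷⁻ e W h
  ... | inj₁ (refl , refl) = here refl
  ... | inj₂ h′            = there (uses⇒source∈ W h′)

  uses⇒target∈ : (W : Walk E u v) → Uses W a b → b ∈ vertices E W
  uses⇒target∈ (e ∷ W) h with uses-∷⁻ e W h
  ... | inj₁ (refl , refl) = there (start∈ W)
  ... | inj₂ h′            = there (uses⇒target∈ W h′)

  ∈-++ʷ⁺ˡ : (W₁ : Walk E u z) (W₂ : Walk E z v) →
            x ∈ vertices E W₁ → x ∈ vertices E (W₁ ++ʷ W₂)
  ∈-++ʷ⁺ˡ []       W₂ (here refl) = start∈ W₂
  ∈-++ʷ⁺ˡ (_ ∷ _)  W₂ (here refl) = here refl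
  ∈-++ʷ⁺ˡ (_ ∷ W₁) W₂ (there x∈)  = there (∈-++ʷ⁺ˡ W₁ W₂ x∈)

  ∈-++ʷ⁺ʳ : (W₁ : Walk E u z) (W₂ : Walk E z v) →
            x ∈ vertices E W₂ → x ∈ vertices E (W₁ ++ʷ W₂)
  ∈-++ʷ⁺ʳ []       W₂ x∈ = x∈
  ∈-++ʷ⁺ʳ (_ ∷ W₁) W₂ x∈ = there (∈-++ʷ⁺ʳ W₁ W₂ x∈)

  simple-++⁻ˡ : (W₁ : Walk E u z) (W₂ : Walk E z v) → Simple (W₁ ++ʷ W₂) → Simple W₁
  simple-++⁻ˡ []       W₂ _         = [] ∷ []
  simple-++⁻ˡ (_ ∷ W₁) W₂ (u∉ ∷ s) =
    All.tabulate (All.lookup u∉ ∘ ∈-++ʷ⁺ˡ W₁ W₂) ∷ simple-++⁻ˡ W₁ W₂ s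

  simple-++⁻ʳ : (W₁ : Walk E u z) (W₂ : Walk E z v) → Simple (W₁ ++ʷ W₂) → Simple W₂
  simple-++⁻ʳ []       W₂ s       = s
  simple-++⁻ʳ (_ ∷ W₁) W₂ (_ ∷ s) = simple-++⁻ʳ W₁ W₂ s

  simple-++-junction : (W₁ : Walk E u z) (W₂ : Walk E z v) → Simple (W₁ ++ʷ W₂) →
                       x ∈ vertices E W₁ → x ∈ vertices E W₂ → x ≡ z
  simple-++-junction []       W₂ _        (here refl)  _    = refl
  simple-++-junction (_ ∷ W₁) W₂ (u∉ ∷ _) (here refl)  x∈W₂ =
    ⊥-elim (All¬⇒¬Any u∉ (∈-++ʷ⁺ʳ W₁ W₂ x∈W₂))
  simple-++-junction (_ ∷ W₁) W₂ (_ ∷ s)  (there x∈W₁) x∈W₂ =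
    simple-++-junction W₁ W₂ s x∈W₁ x∈W₂

  simple-++-disjoint : (W₁ : Walk E u z) (W₂ : Walk E z v) → Simple (W₁ ++ʷ W₂) →
                       Uses W₁ a b → ¬ Uses W₂ a b
  simple-++-disjoint (e ∷ W₁) W₂ (u∉ ∷ s) h₁ h₂ with uses-∷⁻ e W₁ h₁
  ... | inj₁ (refl , refl) = All¬⇒¬Any u∉ (∈-++ʷ⁺ʳ W₁ W₂ (uses⇒source∈ W₂ h₂))
  ... | inj₂ h₁′           = simple-++-disjoint W₁ W₂ s h₁′ h₂

  simple⇒target≢start : (W : Walk E u v) → Simple W → Uses W a b → b ≢ u
  simple⇒target≢start (e ∷ W) (u∉ ∷ _) h refl with uses-∷⁻ e W h
  ... | inj₁ (refl , refl) = All¬⇒¬Any u∉ (start∈ W)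
  ... | inj₂ h′            = All¬⇒¬Any u∉ (uses⇒target∈ W h′)

  count : Walk E u v → Fin n → Fin n → ℕ
  count W a b = b2n E (usesW E W a b)

  count-++ : (W₁ : Walk E u z) (W₂ : Walk E z v) → Simple (W₁ ++ʷ W₂) →
             ∀ a b → count (W₁ ++ʷ W₂) a b ≡ count W₁ a b + count W₂ a b
  count-++ W₁ W₂ s a b rewrite uses-++ W₁ W₂ a b with usesW E W₁ a b in p | usesW E W₂ a b in q
  ... | true  | true  = ⊥-elim (simple-++-disjoint W₁ W₂ s (subst T (sym p) _) (subst T (sym q) _))
  ... | true  | false = refl
  ... | false | _     = refl

  uses⇒count≡1 : (W : Walk E u v) → Uses W a b → count W a b ≡ 1
  uses⇒count≡1 {a = a} {b} W h with usesW E W a b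
  ... | true = refl

  ¬uses⇒count≡0 : (W : Walk E u v) → ¬ Uses W a b → count W a b ≡ 0
  ¬uses⇒count≡0 {a = a} {b} W ¬h with usesW E W a b
  ... | true  = ⊥-elim (¬h _)
  ... | false = refl

  0<count⇒uses : (W : Walk E u v) → 0 < count W a b → Uses W a b
  0<count⇒uses {a = a} {b} W 0<count with usesW E W a b
  ... | true = _

  castStart : u ≡ x → Path E u v → Path E x v
  castStart refl P = P

  count-castStart : (u≡x : u ≡ x) (P : Path E u v) →
                    count (proj₁ (castStart u≡x P)) a b ≡ count (proj₁ P) a b
  count-castStart refl P = refl

  record Split (W : Walk E u v) (z : Fin n) : Set where
    constructor split
    field
      prefix : Walk E u z
      suffix : Walk E z v
      joins  : prefix ++ʷ suffix ≡ W

  splitAt : (W : Walk E u v) → z ∈ vertices E W → Split W z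
  splitAt []      (here refl) = split [] [] refl
  splitAt (e ∷ W) (here refl) = split [] (e ∷ W) refl
  splitAt (e ∷ W) (there z∈W) with splitAt W z∈W
  ... | split p s joins = split (e ∷ p) s (cong (e ∷_) joins)

  module _ {W : Walk E u v} where

    prefix-⊆ : (sp : Split W z) → Split.prefix sp ⊆ᵉ W
    prefix-⊆ (split p s refl) = uses-++⁺ˡ p s

    suffix-⊆ : (sp : Split W z) → Split.suffix sp ⊆ᵉ W
    suffix-⊆ (split p s refl) = uses-++⁺ʳ p s

    prefix-simple : (sp : Split W z) → Simple W → Simple (Split.prefix sp)
    prefix-simple (split p s refl) = simple-++⁻ˡ p s

    suffix-simple : (sp : Split W z) → Simple W → Simple (Split.suffix sp)
    suffix-simple (split p s refl) = simple-++⁻ʳ p s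

    count-split : (sp : Split W z) → Simple W →
                  ∀ a b → count W a b ≡ count (Split.prefix sp) a b + count (Split.suffix sp) a b
    count-split (split p s refl) = count-++ p s

    split-disjoint : (sp : Split W z) → Simple W → Uses (Split.prefix sp) a b → ¬ Uses (Split.suffix sp) a b
    split-disjoint (split p s refl) = simple-++-disjoint p s

  -- The shared edge ends at b ≢ u, so cutting Q and P at b leaves u only in the discarded pieces.
  bypass : (Q : Walk E x u) (P : Walk E u v) → Simple Q → Simple P → Uses Q a b → Uses P a b →
           Σ[ R ∈ Walk E x v ] (∀ {c d} → Uses R c d → Uses Q c d ⊎ Uses P c d) ×
                               (∀ {y} → ¬ Uses R u y)
  bypass {u = u} {b = b} Q P Q-simple P-simple inQ inP
    with splitAt Q (uses⇒target∈ Q inQ) | splitAt P (uses⇒target∈ P inP)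
  ... | split Q₁ Q₂ refl | split P₁ P₂ refl =
    Q₁ ++ʷ P₂ , Sum.map (uses-++⁺ˡ Q₁ Q₂) (uses-++⁺ʳ P₁ P₂) ∘ uses-++⁻ Q₁ P₂ , avoids-u
    where
    b≢u : b ≢ u
    b≢u = simple⇒target≢start (P₁ ++ʷ P₂) P-simple inP
    avoids-u : ∀ {y} → ¬ Uses (Q₁ ++ʷ P₂) u y
    avoids-u h with uses-++⁻ Q₁ P₂ h
    ... | inj₁ h₁ = b≢u (sym (simple-++-junction Q₁ Q₂ Q-simple (uses⇒source∈ Q₁ h₁) (end∈ Q₂)))
    ... | inj₂ h₂ = b≢u (sym (simple-++-junction P₁ P₂ P-simple (start∈ P₁) (uses⇒source∈ P₂ h₂)))

  record FirstStep (W : Walk E u v) : Set where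
    constructor firstStep
    field
      {second} : Fin n
      edge     : E u second ≡ true
      rest     : Walk E second v
      begins   : W ≡ edge ∷ rest

  record LastStep (W : Walk E u v) : Set where
    constructor lastStep
    field
      {penultimate} : Fin n
      front         : Walk E u penultimate
      edge          : E penultimate v ≡ true
      ends          : W ≡ front ++ʷ (edge ∷ [])

  firstStep-uses : {W : Walk E u v} (s : FirstStep W) → Uses W u (FirstStep.second s)
  firstStep-uses (firstStep e rest refl) = uses-++⁺ˡ (e ∷ []) rest (uses-edge⁺ e)

  firstStep? : (W : Walk E u v) → (u ≡ v × ∀ {a b} → ¬ Uses W a b) ⊎ FirstStep W
  firstStep? []      = inj₁ (refl , λ ())
  firstStep? (e ∷ W) = inj₂ (firstStep e W refl)

  lastStep-∷ : (e : E u w ≡ true) (W : Walk E w v) → LastStep (e ∷ W)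
  lastStep-∷ e []       = lastStep [] e refl
  lastStep-∷ e (e′ ∷ W) with lastStep-∷ e′ W
  ... | lastStep f e″ ends = lastStep (e ∷ f) e″ (cong (e ∷_) ends)

  lastStep? : (W : Walk E u v) → (u ≡ v × ∀ {a b} → ¬ Uses W a b) ⊎ LastStep W
  lastStep? []      = inj₁ (refl , λ ())
  lastStep? (e ∷ W) = inj₂ (lastStep-∷ e W)

  length : Walk E u v → ℕ
  length []      = 0
  length (_ ∷ W) = suc (length W)

  length-vertices : (W : Walk E u v) → List.length (vertices E W) ≡ suc (length W)
  length-vertices []      = refl
  length-vertices (_ ∷ W) = cong suc (length-vertices W)

  simple⇒length< : (W : Walk E u v) → Simple W → length W < n
  simple⇒length< W s = subst (_≤ n) (length-vertices W) (unique⇒length≤ s)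

  prependEdge : Dec (E u w ≡ true) → List (Walk E w v) → List (Walk E u v)
  prependEdge (yes e) Ws = List.map (e ∷_) Ws
  prependEdge (no _)  _  = []

  walksOfLength : ℕ → (u v : Fin n) → List (Walk E u v)
  walksOfLength zero    u v with u ≟ v
  ... | yes refl = [] ∷ []
  ... | no _     = []
  walksOfLength (suc m) u v =
    List.concatMap (λ w → prependEdge (E u w Bool.≟ true) (walksOfLength m w v)) (List.allFin n)

  ∈-walksOfLength : (W : Walk E u v) → W ∈ walksOfLength (length W) u v
  ∈-walksOfLength {u} [] with u ≟ u
  ... | yes refl = here refl
  ... | no u≢u   = ⊥-elim (u≢u refl)
  ∈-walksOfLength {u} (_∷_ {w = w} e W) = ∈-concatMap⁺ _ (lose (∈-allFin w) e∷W∈)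
    where
    e∷W∈ : e ∷ W ∈ prependEdge (E u w Bool.≟ true) (walksOfLength (length W) w _)
    e∷W∈ rewrite dec-yes-irr (E u w Bool.≟ true) (Decidable⇒UIP.≡-irrelevant Bool._≟_) e =
      ∈-map⁺ (e ∷_) (∈-walksOfLength W)

  shortWalks : (u v : Fin n) → List (Walk E u v)
  shortWalks u v = List.concatMap (λ m → walksOfLength m u v) (List.upTo n)

  path∈shortWalks : (P : Path E u v) → proj₁ P ∈ shortWalks u v
  path∈shortWalks (W , s) = ∈-concatMap⁺ _ (lose (∈-upTo⁺ (simple⇒length< W s)) (∈-walksOfLength W))

  module _ (ω : Weight n) (ω≥0 : NonNeg ω) where

    weight-++ : (W₁ : Walk E u z) (W₂ : Walk E z v) →
                weightW E ω (W₁ ++ʷ W₂) ≡ weightW E ω W₁ ℚ.+ weightW E ω W₂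
    weight-++ []                     W₂ = sym (ℚ.+-identityˡ _)
    weight-++ {u} (_∷_ {w = w} _ W₁) W₂ =
      trans (cong (ω u w ℚ.+_) (weight-++ W₁ W₂)) (sym (ℚ.+-assoc (ω u w) _ _))

    weight-nonNeg : (W : Walk E u v) → 0ℚ ≤ℚ weightW E ω W
    weight-nonNeg []                    = ℚ.≤-refl
    weight-nonNeg {u} (_∷_ {w = w} _ W) = ℚ.≤-trans (weight-nonNeg W) (q≥0⇒p≤q+p (ω≥0 u w))

    weight-suffix≤ : {W : Walk E u v} (sp : Split W z) → weightW E ω (Split.suffix sp) ≤ℚ weightW E ω W
    weight-suffix≤ (split l r refl) =
      ℚ.≤-trans (q≥0⇒p≤q+p (weight-nonNeg l)) (ℚ.≤-reflexive (sym (weight-++ l r)))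

    shortcut : (W : Walk E u v) → Σ[ P ∈ Path E u v ] proj₁ P ⊆ᵉ W × weight E ω P ≤ℚ weightW E ω W
    shortcut []                      = ([] , [] ∷ []) , id , ℚ.≤-refl
    shortcut {u} (_∷_ {w = w} e W) with shortcut W
    ... | (P , P-simple) , P⊆W , P≤W with u ∈? vertices E P
    ...   | no u∉P  = (e ∷ P , ¬Any⇒All¬ _ u∉P ∷ P-simple) ,
                      [ uses-++⁺ˡ (e ∷ []) W , uses-++⁺ʳ (e ∷ []) W ∘ P⊆W ]′ ∘ uses-++⁻ (e ∷ []) P ,
                      ℚ.+-monoʳ-≤ (ω u w) P≤W
    ...   | yes u∈P = (Split.suffix sp , suffix-simple sp P-simple) ,
                      uses-++⁺ʳ (e ∷ []) W ∘ P⊆W ∘ suffix-⊆ sp ,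
                      ℚ.≤-trans (weight-suffix≤ sp) (ℚ.≤-trans P≤W (q≥0⇒p≤q+p (ω≥0 u w)))
      where
      sp : Split P u
      sp = splitAt P u∈P

    shortestPath : (W : Walk E u v) → Σ[ P ∈ Path E u v ] Shortest E ω P × weight E ω P ≤ℚ weightW E ω W
    shortestPath {u} {v} W with shortcut W
    ... | (W′ , _) , _ , W′≤W with shortcut (argmin (weightW E ω) W′ (shortWalks u v))
    ...   | P , _ , P≤best = P , P-shortest , ℚ.≤-trans P≤best (ℚ.≤-trans best≤W′ W′≤W)
      where
      best≤W′ : weightW E ω (argmin (weightW E ω) W′ (shortWalks u v)) ≤ℚ weightW E ω W′
      best≤W′ = f[argmin]≤f[⊤] {f = weightW E ω} W′ (shortWalks u v)
      P-shortest : Shortest E ω P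
      P-shortest Q = ℚ.≤-trans P≤best
        (All.lookup (f[argmin]≤f[xs] {f = weightW E ω} W′ (shortWalks u v)) (path∈shortWalks Q))

module Budgets {n : ℕ} (E : Graph n) (ω : Weight n) (ω≥0 : NonNeg ω) where

  open Walks E
  open import Data.Rational using (_+_; _*_)
  open import Algebra.Properties.CommutativeSemigroup
    (CommutativeMonoid.commutativeSemigroup ℚ.+-0-commutativeMonoid) using (x∙yz≈y∙xz)

  private variable
    u v w x y a b : Fin n

  Budget : Set
  Budget = Fin n → Fin n → ℕ

  infix 4 _≤ᵇ_
  _≤ᵇ_ : Budget → Budget → Set
  M′ ≤ᵇ M = ∀ a b → M′ a b ≤ M a b

  infixl 6 _∖_
  _∖_ : Budget → Walk E u v → Budget
  (M ∖ W) a b = M a b ∸ count W a b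

  Covers : Budget → Walk E u v → Set
  Covers M W = ∀ {a b} → Uses W a b → 1 ≤ M a b

  ∖-≤ : (M : Budget) (W : Walk E u v) → M ∖ W ≤ᵇ M
  ∖-≤ M W a b = ℕ.m∸n≤m (M a b) (count W a b)

  ∖-inside : (M : Budget) (W : Walk E u v) → Covers M W → Uses W a b → suc ((M ∖ W) a b) ≡ M a b
  ∖-inside {a = a} {b} M W covers uses with 1≤M ← covers uses | usesW E W a b
  ... | true  = ℕ.m+[n∸m]≡n 1≤M
  ... | false = ⊥-elim uses

  covers-∖ : (M : Budget) (S : Walk E x y) (W : Walk E u v) → Covers M W →
             (∀ {a b} → Uses W a b → Uses S a b → 1 < M a b) → Covers (M ∖ S) W
  covers-∖ M S W covers shared {a} {b} h with usesW E S a b in eq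
  ... | false = covers h
  ... | true  = ℕ.∸-monoˡ-≤ 1 (shared h (subst T (sym eq) _))

  covers-∖-disjoint : (M : Budget) (S : Walk E x y) (W : Walk E u v) → Covers M W →
                      (∀ {a b} → Uses W a b → ¬ Uses S a b) → Covers (M ∖ S) W
  covers-∖-disjoint M S W covers disjoint = covers-∖ M S W covers (λ h h-S → ⊥-elim (disjoint h h-S))

  ∖-++ : (M : Budget) (W₁ : Walk E u v) (W₂ : Walk E v w) → Simple (W₁ ++ʷ W₂) →
         ∀ a b → (M ∖ (W₁ ++ʷ W₂)) a b ≡ (M ∖ W₁ ∖ W₂) a b
  ∖-++ M W₁ W₂ s a b =
    trans (cong (M a b ∸_) (count-++ W₁ W₂ s a b)) (sym (ℕ.∸-+-assoc (M a b) (count W₁ a b) (count W₂ a b)))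

  ℕtoℚ-suc : ∀ m → ℕtoℚ E (suc m) ≡ 1ℚ + ℕtoℚ E m
  ℕtoℚ-suc m = ℚ.toℚᵘ-injective (begin
    ℚ.toℚᵘ (ℕtoℚ E (suc m))          ≈⟨ ℚ.toℚᵘ-fromℚᵘ (ℚᵘ.mkℚᵘ (ℤ.+ suc m) 0) ⟩
    ℚᵘ.mkℚᵘ (ℤ.+ suc m) 0            ≈⟨ ℚᵘ.*≡* (trans (ℤ.*-identityʳ _) (sym (trans (ℤ.*-identityʳ _)
                                          (cong₂ ℤ._+_ (ℤ.*-identityʳ (ℤ.+ 1)) (ℤ.*-identityʳ (ℤ.+ m)))))) ⟩
    ℚᵘ.1ℚᵘ ℚᵘ.+ ℚᵘ.mkℚᵘ (ℤ.+ m) 0    ≈⟨ ℚᵘ.+-congʳ ℚᵘ.1ℚᵘ (ℚ.toℚᵘ-fromℚᵘ (ℚᵘ.mkℚᵘ (ℤ.+ m) 0)) ⟨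
    ℚᵘ.1ℚᵘ ℚᵘ.+ ℚ.toℚᵘ (ℕtoℚ E m)    ≈⟨ ℚ.toℚᵘ-homo-+ 1ℚ (ℕtoℚ E m) ⟨
    ℚ.toℚᵘ (1ℚ + ℕtoℚ E m)           ∎)
    where open ℚᵘ.≃-Reasoning

  ℕtoℚ-nonNeg : ∀ m → 0ℚ ≤ℚ ℕtoℚ E m
  ℕtoℚ-nonNeg m = ℚ.nonNegative⁻¹ _ {{ℚ.normalize-nonNeg m 1}}

  ℕtoℚ-mono : ∀ {m m′} → m ≤ m′ → ℕtoℚ E m ≤ℚ ℕtoℚ E m′
  ℕtoℚ-mono {m′ = m′} z≤n = ℕtoℚ-nonNeg m′
  ℕtoℚ-mono (s≤s {m} {m′} m≤m′) =
    subst₂ _≤ℚ_ (sym (ℕtoℚ-suc m)) (sym (ℕtoℚ-suc m′)) (ℚ.+-monoʳ-≤ 1ℚ (ℕtoℚ-mono m≤m′))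

  edge∈edges : E a b ≡ true → (a , b) ∈ edges E
  edge∈edges {a} {b} e =
    ∈-concatMap⁺ _ (lose (∈-allFin a) (∈-map⁺ _ (∈-filter⁺ (λ b → E a b Bool.≟ true) (∈-allFin b) e)))

  costOver : List (Fin n × Fin n) → Budget → ℚ
  costOver []             M = 0ℚ
  costOver ((a , b) ∷ es) M = ω a b * ℕtoℚ E (M a b) + costOver es M

  cost : Budget → ℚ
  cost = costOver (edges E)

  size : Budget → ℕ
  size M = sum (map (λ (a , b) → M a b) (edges E))

  term-mono : ∀ a b {m m′} → m ≤ m′ → ω a b * ℕtoℚ E m ≤ℚ ω a b * ℕtoℚ E m′
  term-mono a b m≤m′ = ℚ.*-monoˡ-≤-nonNeg (ω a b) {{ℚ.nonNegative (ω≥0 a b)}} (ℕtoℚ-mono m≤m′)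

  term-suc : ∀ a b m → ω a b * ℕtoℚ E (suc m) ≡ ω a b + ω a b * ℕtoℚ E m
  term-suc a b m = begin
    ω a b * ℕtoℚ E (suc m)              ≡⟨ cong (ω a b *_) (ℕtoℚ-suc m) ⟩
    ω a b * (1ℚ + ℕtoℚ E m)             ≡⟨ ℚ.*-distribˡ-+ (ω a b) 1ℚ (ℕtoℚ E m) ⟩
    ω a b * 1ℚ + ω a b * ℕtoℚ E m       ≡⟨ cong (_+ ω a b * ℕtoℚ E m) (ℚ.*-identityʳ (ω a b)) ⟩
    ω a b + ω a b * ℕtoℚ E m            ∎
    where open ≡-Reasoning

  costOver-mono : ∀ {M′ M} → M′ ≤ᵇ M → ∀ es → costOver es M′ ≤ℚ costOver es M
  costOver-mono M′≤M []             = ℚ.≤-refl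
  costOver-mono M′≤M ((a , b) ∷ es) = ℚ.+-mono-≤ (term-mono a b (M′≤M a b)) (costOver-mono M′≤M es)

  costOver-cong : ∀ {M′ M} → (∀ a b → M′ a b ≡ M a b) → ∀ es → costOver es M′ ≡ costOver es M
  costOver-cong M′≡M []             = refl
  costOver-cong M′≡M ((a , b) ∷ es) =
    cong₂ _+_ (cong (λ m → ω a b * ℕtoℚ E m) (M′≡M a b)) (costOver-cong M′≡M es)

  costOver-nonNeg : ∀ M es → 0ℚ ≤ℚ costOver es M
  costOver-nonNeg M es = subst (_≤ℚ costOver es M) (costOver-zero es) (costOver-mono (λ _ _ → z≤n) es)
    where
    costOver-zero : ∀ es → costOver es (λ _ _ → 0) ≡ 0ℚ
    costOver-zero []             = refl
    costOver-zero ((a , b) ∷ es) =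
      trans (cong₂ _+_ (ℚ.*-zeroʳ (ω a b)) (costOver-zero es)) (ℚ.+-identityʳ 0ℚ)

  costOver-spend : ∀ {M′ M a b es} → M′ ≤ᵇ M → (a , b) ∈ es → suc (M′ a b) ≤ M a b →
                   ω a b + costOver es M′ ≤ℚ costOver es M
  costOver-spend {M′} {M} {a} {b} {_ ∷ es} M′≤M (here refl) M′<M = begin
    ω a b + (ω a b * ℕtoℚ E (M′ a b) + costOver es M′)  ≡⟨ ℚ.+-assoc (ω a b) _ _ ⟨
    ω a b + ω a b * ℕtoℚ E (M′ a b) + costOver es M′    ≡⟨ cong (_+ costOver es M′) (term-suc a b (M′ a b)) ⟨
    ω a b * ℕtoℚ E (suc (M′ a b)) + costOver es M′      ≤⟨ ℚ.+-mono-≤ (term-mono a b M′<M)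
                                                                        (costOver-mono M′≤M es) ⟩
    ω a b * ℕtoℚ E (M a b) + costOver es M              ∎
    where open ℚ.≤-Reasoning
  costOver-spend {M′} {M} {a} {b} {(c , d) ∷ es} M′≤M (there ab∈es) M′<M = begin
    ω a b + (ω c d * ℕtoℚ E (M′ c d) + costOver es M′)  ≡⟨ x∙yz≈y∙xz (ω a b) (ω c d * ℕtoℚ E (M′ c d)) _ ⟩
    ω c d * ℕtoℚ E (M′ c d) + (ω a b + costOver es M′)  ≤⟨ ℚ.+-mono-≤ (term-mono c d (M′≤M c d))
                                                                        (costOver-spend M′≤M ab∈es M′<M) ⟩
    ω c d * ℕtoℚ E (M c d) + costOver es M              ∎
    where open ℚ.≤-Reasoning

  cost-∖ : (M : Budget) (W : Walk E u v) → Simple W → Covers M W →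
           weightW E ω W + cost (M ∖ W) ≤ℚ cost M
  cost-∖ M []                  _               _      = ℚ.≤-reflexive (ℚ.+-identityˡ (cost M))
  cost-∖ M (_∷_ {u} {w} e W) s@(_ ∷ W-simple) covers = begin
    ω u w + weightW E ω W + cost (M ∖ (e ∷ W))         ≡⟨ ℚ.+-assoc (ω u w) _ _ ⟩
    ω u w + (weightW E ω W + cost (M ∖ (e ∷ W)))       ≡⟨ cong (λ c → ω u w + (weightW E ω W + c))
                                                              (costOver-cong (∖-++ M (e ∷ []) W s) (edges E)) ⟩
    ω u w + (weightW E ω W + cost (M ∖ (e ∷ []) ∖ W))  ≤⟨ ℚ.+-monoʳ-≤ (ω u w)
                                                              (cost-∖ (M ∖ (e ∷ [])) W W-simple covers′) ⟩
    ω u w + cost (M ∖ (e ∷ []))                        ≤⟨ costOver-spend (∖-≤ M (e ∷ [])) (edge∈edges e)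
                                                              (ℕ.≤-reflexive e-spent) ⟩
    cost M                                             ∎
    where
    open ℚ.≤-Reasoning
    e-spent : suc ((M ∖ (e ∷ [])) u w) ≡ M u w
    e-spent = ∖-inside M (e ∷ []) (covers ∘ uses-++⁺ˡ (e ∷ []) W) (uses-edge⁺ e)
    covers′ : Covers (M ∖ (e ∷ [])) W
    covers′ = covers-∖-disjoint M (e ∷ []) W (covers ∘ uses-++⁺ʳ (e ∷ []) W)
                                (λ h h-e → simple-++-disjoint (e ∷ []) W s h-e h)

  size-∖ : (M : Budget) (W : Walk E u v) → Covers M W → Uses W a b → size (M ∖ W) < size M
  size-∖ M W covers uses =
    subst (_≤ size M) (ℕ.+-comm (size (M ∖ W)) 1)
          (sum-map-mono-+ (λ (c , d) → ∖-≤ M W c d) (edge∈edges (uses⇒edge W uses))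
                          (ℕ.≤-reflexive (trans (ℕ.+-comm _ 1) (∖-inside M W covers uses))))

  module _ {k : ℕ} {s t : Fin n} (F : Fin k → Path E s t) (B : Path E t s) where

    initialBudget : Budget
    initialBudget a b = countUses E F a b ⊔ b2n E (uses E B a b)

    -- scssCost sums with a local function that cannot be named here, so the induction motive is
    -- left for Agda to infer from the goal.
    mutual
      scssCost-motive : List (Fin n × Fin n) → Set
      scssCost-motive = _

      scssCost≡cost : scssCost E ω F B ≡ cost initialBudget
      scssCost≡cost with edges E
      ... | es = list-induction {P = scssCost-motive} refl
                   (λ { (a , b) _ → cong ((ω a b * ℕtoℚ E (initialBudget a b)) +_) }) es

module Game {n : ℕ} (E : Graph n) (ω : Weight n) (ω≥0 : NonNeg ω) (t : Fin n) (k : ℕ) where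

  open import Data.Nat using (_+_)
  open Walks E
  open Budgets E ω ω≥0

  private variable
    u v z : Fin n
    vs : Vec (Fin n) k

  record Routes (vs : Vec (Fin n) k) : Set where
    field route : (i : Fin k) → Path E (lookup vs i) t
  open Routes

  load : Routes vs → Budget
  load P a b = sum (map (λ i → count (proj₁ (route P i)) a b) (allFin k))

  load-covers : (P : Routes vs) {M : Budget} → (∀ a b → load P a b ≤ M a b) →
                ∀ i → Covers M (proj₁ (route P i))
  load-covers P {M} P≤M i {a} {b} uses = begin
    1                              ≡⟨ uses⇒count≡1 (proj₁ (route P i)) uses ⟨
    count (proj₁ (route P i)) a b  ≤⟨ ≤-sum-map (λ j → count (proj₁ (route P j)) a b) (∈-allFin i) ⟩
    load P a b                     ≤⟨ P≤M a b ⟩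
    M a b                          ∎
    where open ℕ.≤-Reasoning

  moveRoute : Routes vs → (j : Fin k) → Path E z t → Routes (vs [ j ]≔ z)
  moveRoute P j P′ = record { route = moved P j P′ }
    where
    moved : Routes vs → (j : Fin k) → Path E z t → (i : Fin k) → Path E (lookup (vs [ j ]≔ z) i) t
    moved {vs} {z} P j P′ i with i ≟ j
    ... | yes refl = castStart (sym (lookup∘update i vs z)) P′
    ... | no i≢j   = castStart (sym (lookup∘update′ i≢j vs z)) (route P i)

  count-moveRoute-≡ : (P : Routes vs) (j : Fin k) (P′ : Path E z t) →
                     ∀ a b → count (proj₁ (route (moveRoute P j P′) j)) a b ≡ count (proj₁ P′) a b
  count-moveRoute-≡ {vs} {z} P j P′ a b with j ≟ j
  ... | yes refl = count-castStart (sym (lookup∘update j vs z)) P′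
  ... | no j≢j   = ⊥-elim (j≢j refl)

  count-moveRoute-≤ : (P : Routes vs) (j : Fin k) (P′ : Path E z t) →
                      (∀ a b → count (proj₁ P′) a b ≤ count (proj₁ (route P j)) a b) →
                      ∀ i a b → count (proj₁ (route (moveRoute P j P′) i)) a b
                                  ≤ count (proj₁ (route P i)) a b
  count-moveRoute-≤ {vs} {z} P j P′ P′≤Pj i a b with i ≟ j
  ... | yes refl =
    ℕ.≤-trans (ℕ.≤-reflexive (count-castStart (sym (lookup∘update i vs z)) P′)) (P′≤Pj a b)
  ... | no i≢j   = ℕ.≤-reflexive (count-castStart (sym (lookup∘update′ i≢j vs z)) (route P i))

  load-advance : (P : Routes vs) (j : Fin k) (sp : Split (proj₁ (route P j)) z) →
                 ∀ {M} → (∀ a b → load P a b ≤ M a b) →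
                 ∀ a b → load (moveRoute P j (Split.suffix sp , suffix-simple sp (proj₂ (route P j)))) a b
                         ≤ (M ∖ Split.prefix sp) a b
  load-advance {vs} {z} P j sp {M} P≤M a b =
    ℕ.m+n≤o⇒m≤o∸n (sum (map moved (allFin k)))
      (ℕ.≤-trans (sum-map-mono-+ {f = before} {g = moved} moved≤ (∈-allFin j) moved-j) (P≤M a b))
    where
    P′ : Path E z t
    P′ = Split.suffix sp , suffix-simple sp (proj₂ (route P j))
    before moved : Fin k → ℕ
    before i = count (proj₁ (route P i)) a b
    moved i = count (proj₁ (route (moveRoute P j P′) i)) a b
    moved-j : moved j + count (Split.prefix sp) a b ≤ before j
    moved-j = ℕ.≤-reflexive (begin
      moved j + count (Split.prefix sp) a b                      ≡⟨ cong (_+ _) (count-moveRoute-≡ P j P′ a b) ⟩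
      count (Split.suffix sp) a b + count (Split.prefix sp) a b  ≡⟨ ℕ.+-comm (count (Split.suffix sp) a b) _ ⟩
      count (Split.prefix sp) a b + count (Split.suffix sp) a b  ≡⟨ count-split sp (proj₂ (route P j)) a b ⟨
      before j                                                    ∎)
      where open ≡-Reasoning
    moved≤ : ∀ i → moved i ≤ before i
    moved≤ i = count-moveRoute-≤ P j P′ suffix≤ i a b
      where
      suffix≤ : ∀ a b → count (Split.suffix sp) a b ≤ count (proj₁ (route P j)) a b
      suffix≤ a b =
        ℕ.≤-trans (ℕ.m≤n+m _ _) (ℕ.≤-reflexive (sym (count-split sp (proj₂ (route P j)) a b)))

  record Invariant (v₀ : Fin n) (vs : Vec (Fin n) k) (M : Budget) : Set where
    field
      routes         : Routes vs
      return         : Path E t v₀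
      load≤budget    : ∀ a b → load routes a b ≤ M a b
      return-covered : Covers M (proj₁ return)

    P : (i : Fin k) → Walk E (lookup vs i) t
    P i = proj₁ (route routes i)

    P-simple : ∀ i → Simple (P i)
    P-simple i = proj₂ (route routes i)

    P-covered : ∀ i → Covers M (P i)
    P-covered = load-covers routes load≤budget

    Q : Walk E t v₀
    Q = proj₁ return

    Q-simple : Simple Q
    Q-simple = proj₂ return

  record Step (v₀ : Fin n) (vs : Vec (Fin n) k) (M : Budget) : Set where
    field
      {v₀′}         : Fin n
      {vs′}         : Vec (Fin n) k
      {price}       : ℚ
      {from to}     : Fin n
      move          : Move E ω (v₀ ∷ vs) price (v₀′ ∷ vs′)
      spent         : Walk E from to
      spent-simple  : Simple spent
      spent-covered : Covers M spent
      spent-edge    : ∃[ a ] ∃[ b ] Uses spent a b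
      price≤weight  : price ≤ℚ weightW E ω spent
      invariant     : Invariant v₀′ vs′ (M ∖ spent)

    size-decreases : size (M ∖ spent) < size M
    size-decreases = size-∖ M spent spent-covered (proj₂ (proj₂ spent-edge))

  module Steps {v₀ : Fin n} {vs : Vec (Fin n) k} {M : Budget} (I : Invariant v₀ vs M) where
    open Invariant I

    forwardStep : (i : Fin k) (s : FirstStep (P i)) → let x = FirstStep.second s in
                  count Q (lookup vs i) x < M (lookup vs i) x → Step v₀ vs M
    forwardStep i (firstStep {x} e rest begins) spare = record
      { move          = forward (v₀ ∷ vs) i x e
      ; spent         = e ∷ []
      ; spent-simple  = prefix-simple sp (P-simple i)
      ; spent-covered = P-covered i ∘ prefix-⊆ sp
      ; spent-edge    = _ , _ , uses-edge⁺ e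
      ; price≤weight  = ℚ.≤-reflexive (sym (ℚ.+-identityʳ _))
      ; invariant     = record
        { routes         = moveRoute routes i (rest , suffix-simple sp (P-simple i))
        ; return         = return
        ; load≤budget    = load-advance routes i sp load≤budget
        ; return-covered = covers-∖ M (e ∷ []) Q return-covered
                             (λ inQ inS → shared-spare inQ (uses-edge⁻ e inS))
        }
      }
      where
      sp : Split (P i) x
      sp = split (e ∷ []) rest (sym begins)
      shared-spare : ∀ {a b} → Uses Q a b → lookup vs i ≡ a × x ≡ b → 1 < M a b
      shared-spare inQ (refl , refl) = subst (_< M _ _) (uses⇒count≡1 Q inQ) spare

    backwardStep : (ls : LastStep Q) → let y = LastStep.penultimate ls in
                   load routes y v₀ < M y v₀ → Step v₀ vs M
    backwardStep (lastStep {y} front e ends) room = record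
      { move          = backward (v₀ ∷ vs) y e
      ; spent         = e ∷ []
      ; spent-simple  = suffix-simple sq Q-simple
      ; spent-covered = return-covered ∘ suffix-⊆ sq
      ; spent-edge    = _ , _ , uses-edge⁺ e
      ; price≤weight  = ℚ.≤-reflexive (sym (ℚ.+-identityʳ _))
      ; invariant     = record
        { routes         = routes
        ; return         = front , prefix-simple sq Q-simple
        ; load≤budget    = λ a b → ℕ.m+n≤o⇒m≤o∸n _ (load+edge≤budget a b)
        ; return-covered = covers-∖-disjoint M (e ∷ []) front (return-covered ∘ prefix-⊆ sq)
                             (split-disjoint sq Q-simple)
        }
      }
      where
      sq : Split Q y
      sq = split front (e ∷ []) (sym ends)
      load+edge≤budget : ∀ a b → load routes a b + count (e ∷ []) a b ≤ M a b
      load+edge≤budget a b with T? (usesW E (e ∷ []) a b)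
      ... | no ¬uses = subst (λ c → load routes a b + c ≤ M a b) (sym (¬uses⇒count≡0 (e ∷ []) ¬uses))
                             (subst (_≤ M a b) (sym (ℕ.+-identityʳ _)) (load≤budget a b))
      ... | yes uses with uses-edge⁻ e uses
      ...   | refl , refl = subst (λ c → load routes a b + c ≤ M a b) (sym (uses⇒count≡1 (e ∷ []) uses))
                                  (subst (_≤ M a b) (ℕ.+-comm 1 _) room)

    flipStep : (j : Fin k) (sp : Split (P j) v₀) (sq : Split Q (lookup vs j)) →
               (∀ {a b} → Uses (Split.prefix sq) a b → ¬ Uses (Split.prefix sp) a b) →
               ∃[ a ] ∃[ b ] Uses (Split.prefix sp) a b → Step v₀ vs M
    flipStep j sp sq disjoint used = record
      { move          = flip (v₀ ∷ vs) j (proj₁ shortest) (proj₁ (proj₂ shortest))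
      ; spent         = Split.prefix sp
      ; spent-simple  = prefix-simple sp (P-simple j)
      ; spent-covered = P-covered j ∘ prefix-⊆ sp
      ; spent-edge    = used
      ; price≤weight  = proj₂ (proj₂ shortest)
      ; invariant     = record
        { routes         = moveRoute routes j (Split.suffix sp , suffix-simple sp (P-simple j))
        ; return         = Split.prefix sq , prefix-simple sq Q-simple
        ; load≤budget    = load-advance routes j sp load≤budget
        ; return-covered = covers-∖-disjoint M (Split.prefix sp) (Split.prefix sq)
                             (return-covered ∘ prefix-⊆ sq) disjoint
        }
      }
      where
      shortest : Σ[ S ∈ Path E (lookup vs j) v₀ ]
                   Shortest E ω S × weight E ω S ≤ℚ weightW E ω (Split.prefix sp)
      shortest = shortestPath ω ω≥0 (Split.prefix sp)

  module Progress {v₀ : Fin n} {vs : Vec (Fin n) k} {M : Budget} (I : Invariant v₀ vs M) where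
    open Invariant I
    open Steps I

    Spare : Walk E u v → Set
    Spare {u} W = Σ[ s ∈ FirstStep W ] count Q u (FirstStep.second s) < M u (FirstStep.second s)

    spare? : (W : Walk E u v) → Dec (Spare W)
    spare? []                         = no λ { (firstStep _ _ () , _) }
    spare? {u} (_∷_ {w = x} e W) with count Q u x ℕ.<? M u x
    ... | yes spare = yes (firstStep e W refl , spare)
    ... | no ¬spare = no λ { (firstStep _ _ refl , spare) → ¬spare spare }

    reroute : (j : Fin k) (sp : Split (P j) v₀) (sq : Split Q (lookup vs j)) {a b : Fin n} →
              Uses (Split.prefix sq) a b → Uses (Split.prefix sp) a b →
              Σ[ Q′ ∈ Path E t v₀ ] Covers M (proj₁ Q′) × (∀ {x} → ¬ Uses (proj₁ Q′) (lookup vs j) x)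
    reroute j sp sq inQ₁ inP₁
      with bypass (Split.prefix sq) (Split.prefix sp) (prefix-simple sq Q-simple) (prefix-simple sp (P-simple j))
                  inQ₁ inP₁
    ... | R , R⊆Q₁∪P₁ , R-avoids with shortcut ω ω≥0 R
    ...   | Q′ , Q′⊆R , _ =
      Q′ , [ return-covered ∘ prefix-⊆ sq , P-covered j ∘ prefix-⊆ sp ]′ ∘ R⊆Q₁∪P₁ ∘ Q′⊆R , R-avoids ∘ Q′⊆R

    ¬spare⇒return-uses : (W : Walk E u v) → Covers M W → ¬ Spare W →
                         (s : FirstStep W) → Uses Q u (FirstStep.second s)
    ¬spare⇒return-uses W covered ¬spare s =
      0<count⇒uses Q (ℕ.≤-trans (covered (firstStep-uses s)) (ℕ.≮⇒≥ (¬spare ∘ (s ,_))))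

    last-edge-used : (ls : LastStep Q) → let y = LastStep.penultimate ls in
                     M y v₀ ≤ load routes y v₀ → ∃[ j ] Uses (P j) y v₀
    last-edge-used (lastStep front e ends) full =
      let j , 0<count = sum-map-positive (allFin k) (ℕ.≤-trans (return-covered inQ) full)
      in  j , 0<count⇒uses (P j) 0<count
      where
      inQ : Uses Q _ v₀
      inQ = suffix-⊆ (split front (e ∷ []) (sym ends)) (uses-edge⁺ e)

    flipOrReroute : (j : Fin k) (s : FirstStep (P j)) (sp : Split (P j) v₀) (sq : Split Q (lookup vs j)) →
                    lookup vs j ≢ v₀ → Step v₀ vs M
    flipOrReroute j s sp sq j≢v₀
      with any? (λ a → any? (λ b → T? (usesW E (Split.prefix sq) a b) ×-dec
                                   T? (usesW E (Split.prefix sp) a b)))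
    ... | yes (_ , _ , inQ₁ , inP₁) with reroute j sp sq inQ₁ inP₁
    ...   | Q′ , Q′-covered , Q′-avoids =
      Steps.forwardStep (record I { return = Q′ ; return-covered = Q′-covered }) j s
        (subst (_< M _ _) (sym (¬uses⇒count≡0 (proj₁ Q′) Q′-avoids)) (P-covered j (firstStep-uses s)))
    flipOrReroute j s sp sq j≢v₀ | no ¬shared with firstStep? (Split.prefix sp)
    ... | inj₁ (j≡v₀ , _) = ⊥-elim (j≢v₀ j≡v₀)
    ... | inj₂ s₁         =
      flipStep j sp sq (λ h₁ h₂ → ¬shared (_ , _ , h₁ , h₂)) (_ , _ , firstStep-uses s₁)

    stuckStep : (∀ i → ¬ Spare (P i)) → (ls : LastStep Q) → let y = LastStep.penultimate ls in
                M y v₀ ≤ load routes y v₀ → Step v₀ vs M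
    stuckStep stuck ls full with last-edge-used ls full
    ... | j , inPj with firstStep? (P j)
    ...   | inj₁ (_ , edgeless) = ⊥-elim (edgeless inPj)
    ...   | inj₂ s = flipOrReroute j s
                       (splitAt (P j) (uses⇒target∈ (P j) inPj))
                       (splitAt Q (uses⇒source∈ Q (¬spare⇒return-uses (P j) (P-covered j) (stuck j) s)))
                       (simple⇒target≢start (P j) (P-simple j) inPj ∘ sym)

    all-at-t : (∀ {a b} → ¬ Uses Q a b) → (∀ i → ¬ Spare (P i)) → ∀ i → lookup vs i ≡ t
    all-at-t Q-edgeless stuck i with firstStep? (P i)
    ... | inj₁ (at-t , _) = at-t
    ... | inj₂ s          =
      ⊥-elim (stuck i (s , subst (_< M _ _) (sym (¬uses⇒count≡0 Q Q-edgeless)) (P-covered i (firstStep-uses s))))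

    progress : (v₀ ≡ t × vs ≡ replicate k t) ⊎ Step v₀ vs M
    progress with any? (λ i → spare? (P i))
    ... | yes (i , s , spare) = inj₂ (forwardStep i s spare)
    ... | no none with lastStep? Q
    ...   | inj₁ (t≡v₀ , Q-edgeless) =
      inj₁ (sym t≡v₀ , ≡-replicate vs (all-at-t Q-edgeless (λ i spare → none (i , spare))))
    ...   | inj₂ ls with load routes (LastStep.penultimate ls) v₀ ℕ.<? M (LastStep.penultimate ls) v₀
    ...     | yes room = inj₂ (backwardStep ls room)
    ...     | no full  = inj₂ (stuckStep (λ i spare → none (i , spare)) ls (ℕ.≮⇒≥ full))

  Reached : Fin n → Vec (Fin n) k → ℚ → Set
  Reached v₀ vs bound = Σ[ c ∈ ℚ ] Moves E ω (v₀ ∷ vs) c (allAt E k t) × c ≤ℚ bound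

  step-reached : ∀ {v₀ vs M} (s : Step v₀ vs M) → let open Step s in
                 Reached v₀′ vs′ (cost (M ∖ spent)) → Reached v₀ vs (cost M)
  step-reached {M = M} s (c , moves , c≤) =
    price ℚ.+ c , step move moves ,
    ℚ.≤-trans (ℚ.+-mono-≤ price≤weight c≤) (cost-∖ M spent spent-simple spent-covered)
    where open Step s

  reach : ∀ {v₀ vs M} → Acc _<_ (size M) → Invariant v₀ vs M → Reached v₀ vs (cost M)
  reach (acc smaller) I with Progress.progress I
  ... | inj₁ (refl , refl) = 0ℚ , done , costOver-nonNeg _ (edges E)
  ... | inj₂ s             = step-reached s (reach (smaller (Step.size-decreases s)) (Step.invariant s))

  initialInvariant : ∀ {s} (F : Fin k → Path E s t) (B : Path E t s) →
                     Invariant s (replicate k s) (initialBudget F B)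
  initialInvariant {s} F B = record
    { routes         = record { route = λ i → castStart (sym (lookup-replicate i s)) (F i) }
    ; return         = B
    ; load≤budget    = λ a b → ℕ.≤-trans
        (sum-map-mono (λ i → ℕ.≤-reflexive (count-castStart (sym (lookup-replicate i s)) (F i))) (allFin k))
        (ℕ.m≤m⊔n (countUses E F a b) _)
    ; return-covered = λ {a} {b} uses →
        subst (_≤ initialBudget F B a b) (uses⇒count≡1 (proj₁ B) uses) (ℕ.m≤n⊔m (countUses E F a b) _)
    }

  tokens-reach-t : ∀ {s} (F : Fin k → Path E s t) (B : Path E t s) →
                   Reached s (replicate k s) (scssCost E ω F B)
  tokens-reach-t F B =
    subst (Reached _ _) (sym (scssCost≡cost F B)) (reach (<-wellFounded _) (initialInvariant F B))

lemma6 : (n : ℕ) (E : Graph n) (ω : Weight n) → NonNeg ω →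
    (s t : Fin n) (k : ℕ) → 1 ≤ k →
    (F : Fin k → Path E s t) (B : Path E t s) →
    Σ ℚ (λ c → Moves E ω (allAt E k s) c (allAt E k t) × c ≤ℚ scssCost E ω F B)
-- The argument works for every k.
lemma6 n E ω ω≥0 s t k _ F B = Game.tokens-reach-t E ω ω≥0 t k F B
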